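{- Let $d$ be a positive integer, let $G$ be a finite connected graph and $f_E:E\to\mathbb{Z}_d$ an e-labeling such that $(G,f_E)$ is compatible. Let $C$ and $C'$ be cycles of odd lengths $r$ and $s$ in $G$ that both pass through a vertex $v_1$, with edges $e_1,\dots,e_r$ and $e'_1,\dots,e'_s$ numbered consecutively so that each cycle starts and ends at $v_1$ (in particular $e_1$ and $e'_1$ are incident to $v_1$). Then $$\sum_{l=1}^{r}(-1)^{r-l}f_E(e_l)\equiv\sum_{l=1}^{s}(-1)^{s-l}f_E(e'_l)\pmod d.$$
   Context: $\mathbb{Z}_d$ denotes the integers modulo $d$. A cycle of length $k$ is a closed walk, not necessarily simple: vertices $v_1,\dots,v_k$ and edges $e_1,\dots,e_k$ with $e_i=(v_i,v_{i+1})$ for $i<k$ and $e_k=(v_k,v_1)$. Even cycle property: every cycle of even length with edges $e_1,\dots,e_{2k}$ satisfies $\sum_{l\text{ odd}}f_E(e_l)\equiv\sum_{l\text{ even}}f_E(e_l)\pmod d$. Odd cycle property ($d$ even): every cycle of odd length with edges $e_1,\dots,e_{2k+1}$ satisfies $\frac d2\sum_l f_E(e_l)\equiv0\pmod d$. $(G,f_E)$ is compatible if $d$ is odd and the even cycle property holds, or $d$ is even and both properties hold. -}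

module Defs where

open import Data.Nat as ℕ using (ℕ; zero; suc; _∸_)
open import Data.Nat.Divisibility as ℕD using ()
open import Data.Nat.DivMod as ℕDM using ()
open import Data.Integer as ℤ using (ℤ; +_; -_; _-_; _*_; _^_)
open import Data.Integer.Divisibility as ℤD using ()
open import Data.Fin using (Fin; toℕ)
open import Data.List using (List; []; _∷_; length)
open import Data.Product using (_×_; _,_; Σ)
open import Data.Sum using (_⊎_)
open import Relation.Binary.PropositionalEquality using (_≡_)
open import Relation.Nullary using (¬_)

-- A finite (multi)graph: vertices Fin n, edges Fin m, each edge having an
-- (unordered) pair of endpoints, given as an ordered pair read up to swap.
record Graph : Set where
  field
    nV   : ℕ
    nE   : ℕ
    ends : Fin nE → Fin nV × Fin nV

open Graph public

V : Graph → Set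
V G = Fin (nV G)

E : Graph → Set
E G = Fin (nE G)

Joins : (G : Graph) → E G → V G → V G → Set
Joins G e u v = (ends G e ≡ (u , v)) ⊎ (ends G e ≡ (v , u))

data Walk (G : Graph) : V G → V G → Set where
  []  : ∀ {u} → Walk G u u
  _∷⟨_⟩_ : ∀ {u v w} (e : E G) → Joins G e u v → Walk G v w → Walk G u w

edges : ∀ {G u w} → Walk G u w → List (E G)
edges [] = []
edges (e ∷⟨ _ ⟩ p) = e ∷ edges p

len : ∀ {G u w} → Walk G u w → ℕ
len p = length (edges p)

Connected : Graph → Set
Connected G = (u v : V G) → Walk G u v

-- A cycle (closed walk, not necessarily simple) through v of length k:
-- a closed walk from v to v with k edges.  Length 0 walks are excluded
-- wherever a parity/length condition is imposed below.

-- e-labeling with values in ℤ_d, represented by residues Fin d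
Labeling : Graph → ℕ → Set
Labeling G d = E G → Fin d

infix 4 _≡ₘ_[mod_]
_≡ₘ_[mod_] : ℤ → ℤ → ℕ → Set
a ≡ₘ b [mod d ] = (+ d) ℤD.∣ (a - b)

Even : ℕ → Set
Even k = 2 ℕD.∣ k

Odd : ℕ → Set
Odd k = ¬ Even k

lab : ∀ {G d} → Labeling G d → E G → ℤ
lab f e = + toℕ (f e)

-- Σ_{l odd} x_l  and  Σ_{l even} x_l  (positions counted from 1)
mutual
  sumOddPos : List ℤ → ℤ
  sumOddPos [] = + 0
  sumOddPos (x ∷ xs) = x ℤ.+ sumEvenPos xs

  sumEvenPos : List ℤ → ℤ
  sumEvenPos [] = + 0
  sumEvenPos (x ∷ xs) = sumOddPos xs

sumℤ : List ℤ → ℤ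
sumℤ [] = + 0
sumℤ (x ∷ xs) = x ℤ.+ sumℤ xs

labels : ∀ {G d u w} → Labeling G d → Walk G u w → List ℤ
labels {G} {d} f p = Data.List.map (lab {G} {d} f) (edges p)
  where import Data.List

signedSumFrom : ℕ → ℕ → List ℤ → ℤ
signedSumFrom r l [] = + 0
signedSumFrom r l (x ∷ xs) = ((- (+ 1)) ^ (r ∸ l)) * x ℤ.+ signedSumFrom r (suc l) xs

signedSum : List ℤ → ℤ
signedSum xs = signedSumFrom (length xs) 1 xs

EvenCycleProperty : (G : Graph) (d : ℕ) → Labeling G d → Set
EvenCycleProperty G d f =
  ∀ (v : V G) (c : Walk G v v) → 0 ℕ.< len c → Even (len c) →
  sumOddPos (labels f c) ≡ₘ sumEvenPos (labels f c) [mod d ]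

OddCycleProperty : (G : Graph) (d : ℕ) → Labeling G d → Set
OddCycleProperty G d f =
  ∀ (v : V G) (c : Walk G v v) → Odd (len c) →
  (+ (d ℕDM./ 2)) * sumℤ (labels f c) ≡ₘ (+ 0) [mod d ]

Compatible : (G : Graph) (d : ℕ) → Labeling G d → Set
Compatible G d f =
  (Odd d × EvenCycleProperty G d f)
  ⊎ (Even d × EvenCycleProperty G d f × OddCycleProperty G d f)

module Submission where

-- For a list x₁ … x_r write  alt xs = Σ_{l odd} x_l − Σ_{l even} x_l
-- for its alternating sum.  Then
--   (1) alt (xs ++ ys) = alt xs + (−1)^|xs| · alt ys,
--   (2) signedSum xs   = alt (reverse xs)   (the last entry carries sign +).
-- Given odd closed walks C, C′ at v₁, traverse C′ followed by C and reverse the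
-- result.  This is a closed walk W whose label list is  rev L ++ rev L′  (L, L′
-- the label lists of C, C′); its length |C| + |C′| is positive and even, so the
-- even cycle property gives d ∣ alt (rev L ++ rev L′).  Since |rev L| is odd,
-- (1) and (2) turn this alternating sum into  signedSum L − signedSum L′.

open import Defs
open import Data.Nat as ℕ using (ℕ; _<_; zero; suc; _∸_; s≤s; z≤n)
import Data.Nat.Properties as ℕP
import Data.Nat.Tactic.RingSolver as ℕSolver
open import Data.Nat.Divisibility using (divides; m%n≡0⇒n∣m)
open import Data.Nat.DivMod using (_%_; _/_; m≡m%n+[m/n]*n; m%n<n)
open import Data.Integer using (ℤ; +_; -_; _+_; _-_; _*_; _^_)
import Data.Integer.Divisibility as ℤD
import Data.Integer.Properties as ℤP
open import Data.Integer.Tactic.RingSolver using (solve-∀)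
open import Data.List using (List; []; _∷_; length; _++_; reverse; map; [_])
import Data.List.Properties as ListP
open import Data.Product using (Σ; _,_)
open import Data.Sum using (inj₁; inj₂)
open import Data.Empty using (⊥-elim)
open import Relation.Binary.PropositionalEquality
  using (_≡_; refl; sym; trans; cong; cong₂; subst; module ≡-Reasoning)
open import Function using (_∘_)

open ≡-Reasoning

alt : List ℤ → ℤ
alt xs = sumOddPos xs - sumEvenPos xs

-- Prepending an entry shifts every old entry to the opposite parity.
alt-∷ : ∀ x xs → alt (x ∷ xs) ≡ x - alt xs
alt-∷ x xs = shift x (sumEvenPos xs) (sumOddPos xs)
  where
  shift : ∀ a e o → (a + e) - o ≡ a - (o - e)
  shift = solve-∀

alt-[_] : ∀ x → alt [ x ] ≡ x
alt-[ x ] = singleton x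
  where
  singleton : ∀ a → (a + + 0) - + 0 ≡ a
  singleton = solve-∀

alt-++ : ∀ xs ys → alt (xs ++ ys) ≡ alt xs + (- + 1) ^ length xs * alt ys
alt-++ [] ys = sym (trans (ℤP.+-identityˡ _) (ℤP.*-identityˡ (alt ys)))
alt-++ (x ∷ xs) ys = begin
  alt (x ∷ xs ++ ys)
    ≡⟨ alt-∷ x (xs ++ ys) ⟩
  x - alt (xs ++ ys)
    ≡⟨ cong (λ t → x - t) (alt-++ xs ys) ⟩
  x - (alt xs + (- + 1) ^ length xs * alt ys)
    ≡⟨ regroup x (alt xs) ((- + 1) ^ length xs) (alt ys) ⟩
  (x - alt xs) + (- + 1) ^ length (x ∷ xs) * alt ys
    ≡⟨ cong (_+ (- + 1) ^ length (x ∷ xs) * alt ys) (sym (alt-∷ x xs)) ⟩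
  alt (x ∷ xs) + (- + 1) ^ length (x ∷ xs) * alt ys ∎
  where
  regroup : ∀ a b s c → a - (b + s * c) ≡ (a - b) + (- + 1) * s * c
  regroup = solve-∀

-- The signed sum Σ (−1)^{r−l} x_l reads the list backwards alternately,
-- starting with sign + at the last entry.  Generalised over the offset k
-- at which signedSumFrom starts counting.
signedSumFrom≡alt-reverse : ∀ k xs →
  signedSumFrom (k ℕ.+ length xs) (suc k) xs ≡ alt (reverse xs)
signedSumFrom≡alt-reverse k [] = refl
signedSumFrom≡alt-reverse k (x ∷ xs) = begin
  (- + 1) ^ (k ℕ.+ suc n ∸ suc k) * x + signedSumFrom (k ℕ.+ suc n) (suc (suc k)) xs
    ≡⟨ cong₂ (λ e r → (- + 1) ^ e * x + signedSumFrom r (suc (suc k)) xs)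
             exponent (ℕP.+-suc k n) ⟩
  (- + 1) ^ n * x + signedSumFrom (suc k ℕ.+ n) (suc (suc k)) xs
    ≡⟨ cong (λ t → (- + 1) ^ n * x + t) (signedSumFrom≡alt-reverse (suc k) xs) ⟩
  (- + 1) ^ n * x + alt (reverse xs)
    ≡⟨ ℤP.+-comm _ (alt (reverse xs)) ⟩
  alt (reverse xs) + (- + 1) ^ n * x
    ≡⟨ cong₂ (λ m y → alt (reverse xs) + (- + 1) ^ m * y)
             (sym (ListP.length-reverse xs)) (sym (alt-[ x ])) ⟩
  alt (reverse xs) + (- + 1) ^ length (reverse xs) * alt [ x ]
    ≡⟨ sym (alt-++ (reverse xs) [ x ]) ⟩
  alt (reverse xs ++ [ x ])
    ≡⟨ cong alt (sym (ListP.unfold-reverse x xs)) ⟩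
  alt (reverse (x ∷ xs)) ∎
  where
  n = length xs
  exponent : k ℕ.+ suc n ∸ suc k ≡ n
  exponent = trans (cong (_∸ suc k) (ℕP.+-suc k n)) (ℕP.m+n∸m≡n k n)

signedSum≡alt-reverse : ∀ xs → signedSum xs ≡ alt (reverse xs)
signedSum≡alt-reverse = signedSumFrom≡alt-reverse 0

odd⇒suc-double : ∀ {n} → Odd n → Σ ℕ λ q → n ≡ suc (q ℕ.* 2)
odd⇒suc-double {n} odd with n % 2 in r | m%n<n n 2
... | 0           | _           = ⊥-elim (odd (m%n≡0⇒n∣m n 2 r))
... | 1           | _           = n / 2 , trans (m≡m%n+[m/n]*n n 2) (cong (ℕ._+ n / 2 ℕ.* 2) r)
... | suc (suc _) | s≤s (s≤s ())

minus-one-^-odd : ∀ {n} → Odd n → (- + 1) ^ n ≡ - + 1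
minus-one-^-odd odd with odd⇒suc-double odd
... | q , refl = go q
  where
  go : ∀ q → (- + 1) ^ suc (q ℕ.* 2) ≡ - + 1
  go zero    = refl
  go (suc q) = cong (λ t → (- + 1) * ((- + 1) * t)) (go q)

odd+odd-even : ∀ {m n} → Odd m → Odd n → Even (m ℕ.+ n)
odd+odd-even oddM oddN with odd⇒suc-double oddM | odd⇒suc-double oddN
... | a , refl | b , refl = divides (suc (a ℕ.+ b)) (halve a b)
  where
  halve : ∀ a b → suc (a ℕ.* 2) ℕ.+ suc (b ℕ.* 2) ≡ suc (a ℕ.+ b) ℕ.* 2
  halve = ℕSolver.solve-∀

odd+-positive : ∀ {m} n → Odd m → 0 < m ℕ.+ n
odd+-positive n oddM with odd⇒suc-double oddM
... | _ , refl = s≤s z≤n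

module _ {G : Graph} where

  swapJoins : ∀ {e u v} → Joins G e u v → Joins G e v u
  swapJoins (inj₁ uv) = inj₂ uv
  swapJoins (inj₂ vu) = inj₁ vu

  infixr 5 _++w_
  _++w_ : ∀ {u v w} → Walk G u v → Walk G v w → Walk G u w
  []             ++w q = q
  (e ∷⟨ j ⟩ p)   ++w q = e ∷⟨ j ⟩ (p ++w q)

  reverseWalk : ∀ {u v} → Walk G u v → Walk G v u
  reverseWalk []           = []
  reverseWalk (e ∷⟨ j ⟩ p) = reverseWalk p ++w (e ∷⟨ swapJoins j ⟩ [])

  edges-++w : ∀ {u v w} (p : Walk G u v) (q : Walk G v w) →
    edges (p ++w q) ≡ edges p ++ edges q
  edges-++w []           q = refl
  edges-++w (e ∷⟨ _ ⟩ p) q = cong (e ∷_) (edges-++w p q)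

  edges-reverseWalk : ∀ {u v} (p : Walk G u v) → edges (reverseWalk p) ≡ reverse (edges p)
  edges-reverseWalk []           = refl
  edges-reverseWalk (e ∷⟨ j ⟩ p) = begin
    edges (reverseWalk p ++w (e ∷⟨ swapJoins j ⟩ []))  ≡⟨ edges-++w (reverseWalk p) _ ⟩
    edges (reverseWalk p) ++ [ e ]                      ≡⟨ cong (_++ [ e ]) (edges-reverseWalk p) ⟩
    reverse (edges p) ++ [ e ]                          ≡⟨ sym (ListP.unfold-reverse e (edges p)) ⟩
    reverse (e ∷ edges p)                               ∎

  len-++w : ∀ {u v w} (p : Walk G u v) (q : Walk G v w) → len (p ++w q) ≡ len p ℕ.+ len q
  len-++w p q = trans (cong length (edges-++w p q)) (ListP.length-++ (edges p))

  len-reverseWalk : ∀ {u v} (p : Walk G u v) → len (reverseWalk p) ≡ len p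
  len-reverseWalk p = trans (cong length (edges-reverseWalk p)) (ListP.length-reverse (edges p))

  module _ {d : ℕ} (f : Labeling G d) where

    private
      label : E G → ℤ
      label = lab {G} {d} f

    labels-++w : ∀ {u v w} (p : Walk G u v) (q : Walk G v w) →
      labels f (p ++w q) ≡ labels f p ++ labels f q
    labels-++w p q =
      trans (cong (map label) (edges-++w p q)) (ListP.map-++ label (edges p) (edges q))

    labels-reverseWalk : ∀ {u v} (p : Walk G u v) → labels f (reverseWalk p) ≡ reverse (labels f p)
    labels-reverseWalk p =
      trans (cong (map label) (edges-reverseWalk p)) (ListP.reverse-map label (edges p))

    length-labels : ∀ {u v} (p : Walk G u v) → length (labels f p) ≡ len p
    length-labels p = ListP.length-map label (edges p)

evenCycleProperty : ∀ {G d f} → Compatible G d f → EvenCycleProperty G d f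
evenCycleProperty (inj₁ (_ , even))     = even
evenCycleProperty (inj₂ (_ , even , _)) = even

lemma6 : (d : ℕ) → 0 < d → (G : Graph) → Connected G →
    (f : Labeling G d) → Compatible G d f →
    (v₁ : V G) (C C′ : Walk G v₁ v₁) → Odd (len C) → Odd (len C′) →
    signedSum (labels f C) ≡ₘ signedSum (labels f C′) [mod d ]
lemma6 d _ G _ f compatible v₁ C C′ oddC oddC′ =
  subst (+ d ℤD.∣_) alt-W (evenCycleProperty compatible v₁ W positive even)
  where
  L  = labels f C
  L′ = labels f C′
  W = reverseWalk (C′ ++w C)
  len-W : len W ≡ len C′ ℕ.+ len C
  len-W = trans (len-reverseWalk (C′ ++w C)) (len-++w C′ C)
  positive : 0 < len W
  positive = subst (0 <_) (sym len-W) (odd+-positive (len C) oddC′)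
  even : Even (len W)
  even = subst Even (sym len-W) (odd+odd-even oddC′ oddC)
  odd-rev-L : Odd (length (reverse L))
  odd-rev-L = subst Odd (sym (trans (ListP.length-reverse L) (length-labels f C))) oddC
  alt-W : alt (labels f W) ≡ signedSum L - signedSum L′
  alt-W = begin
    alt (labels f W)
      ≡⟨ cong alt (labels-reverseWalk f (C′ ++w C)) ⟩
    alt (reverse (labels f (C′ ++w C)))
      ≡⟨ cong (alt ∘ reverse) (labels-++w f C′ C) ⟩
    alt (reverse (L′ ++ L))
      ≡⟨ cong alt (ListP.reverse-++ L′ L) ⟩
    alt (reverse L ++ reverse L′)
      ≡⟨ alt-++ (reverse L) (reverse L′) ⟩
    alt (reverse L) + (- + 1) ^ length (reverse L) * alt (reverse L′)
      ≡⟨ cong (λ s → alt (reverse L) + s * alt (reverse L′)) (minus-one-^-odd odd-rev-L) ⟩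
    alt (reverse L) + (- + 1) * alt (reverse L′)
      ≡⟨ cong (λ t → alt (reverse L) + t) (ℤP.-1*i≡-i (alt (reverse L′))) ⟩
    alt (reverse L) - alt (reverse L′)
      ≡⟨ sym (cong₂ _-_ (signedSum≡alt-reverse L) (signedSum≡alt-reverse L′)) ⟩
    signedSum L - signedSum L′ ∎
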